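{- (a) On a set $X$ with at least 1 element, no relation $R$ on $X$ satisfies any of: $R^q$ asymmetric for some $q\in\{9,B,D,F\}$; $R^q$ anti-transitive for some $q\in\{9,B,D,F\}$; $R^0$ left serial; $R^q$ reflexive for some $q\in\{0,2,4,6\}$. (b) On a set with at least 2 elements, no relation $R$ has $R^F$ anti-symmetric. (c) On a set with at least 4 elements, no relation $R$ has $R^q$ left unique for some $q\in\{B,D,F\}$.
   Context: A binary relation $R$ on a set $X$ is a subset of $X\times X$; write $xRy$ for $(x,y)\in R$. Unary operations are indexed by hexadecimal digits $p\in\{0,\dots,F\}$, read as 4-bit numbers $p=8p_8+4p_4+2p_2+p_1$. For a relation $R$ on $X$, $xR^py$ iff $(\lnot xRy\land\lnot yRx\land p_8=1)\lor(\lnot xRy\land yRx\land p_4=1)\lor(xRy\land\lnot yRx\land p_2=1)\lor(xRy\land yRx\land p_1=1)$. Properties (free variables universally quantified over $X$): reflexive: $xRx$; asymmetric: $xRy\to\lnot yRx$; anti-symmetric: $xRy\land x\ne y\to\lnot yRx$; anti-transitive: $xRy\land yRz\to\lnot xRz$; left serial: $\forall y\exists x\,xRy$; left unique: $x_1Ry\land x_2Ry\to x_1=x_2$. -}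

module Defs where

open import Level using (Level; _⊔_; suc)
open import Data.Bool using (Bool; true; false)
open import Data.Product using (_×_; ∃; ∃-syntax; Σ-syntax; _,_)
open import Data.Sum using (_⊎_)
open import Relation.Nullary using (¬_)
open import Relation.Binary.PropositionalEquality using (_≡_; _≢_)

Rel : ∀ {a} → Set a → (ℓ : Level) → Set (a ⊔ Level.suc ℓ)
Rel X ℓ = X → X → Set ℓ

-- A hexadecimal digit p = 8 p₈ + 4 p₄ + 2 p₂ + p₁, given by its four bits.
record Hex : Set where
  constructor hex
  field
    p₈ p₄ p₂ p₁ : Bool
open Hex public

h0 h2 h4 h6 h9 hB hD hF : Hex
h0 = hex false false false false
h2 = hex false false true  false
h4 = hex false true  false false
h6 = hex false true  true  false
h9 = hex true  false false true
hB = hex true  false true  true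
hD = hex true  true  false true
hF = hex true  true  true  true

_^_ : ∀ {a ℓ} {X : Set a} → Rel X ℓ → Hex → Rel X ℓ
(R ^ p) x y =
    (¬ R x y × ¬ R y x × p₈ p ≡ true)
  ⊎ (¬ R x y × R y x × p₄ p ≡ true)
  ⊎ (R x y × ¬ R y x × p₂ p ≡ true)
  ⊎ (R x y × R y x × p₁ p ≡ true)

module _ {a ℓ} {X : Set a} (R : Rel X ℓ) where
  Reflexive : Set (a ⊔ ℓ)
  Reflexive = ∀ x → R x x

  Asymmetric : Set (a ⊔ ℓ)
  Asymmetric = ∀ x y → R x y → ¬ R y x

  AntiSymmetric : Set (a ⊔ ℓ)
  AntiSymmetric = ∀ x y → R x y → x ≢ y → ¬ R y x

  AntiTransitive : Set (a ⊔ ℓ)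
  AntiTransitive = ∀ x y z → R x y → R y z → ¬ R x z

  LeftSerial : Set (a ⊔ ℓ)
  LeftSerial = ∀ y → ∃[ x ] R x y

  LeftUnique : Set (a ⊔ ℓ)
  LeftUnique = ∀ x₁ x₂ y → R x₁ y → R x₂ y → x₁ ≡ x₂

AtLeast1 : ∀ {a} → Set a → Set a
AtLeast1 X = X

AtLeast2 : ∀ {a} → Set a → Set a
AtLeast2 X = Σ[ x ∈ X ] Σ[ y ∈ X ] x ≢ y

AtLeast4 : ∀ {a} → Set a → Set a
AtLeast4 X = Σ[ x ∈ X ] Σ[ y ∈ X ] Σ[ z ∈ X ] Σ[ w ∈ X ]
  (x ≢ y × x ≢ z × x ≢ w × y ≢ z × y ≢ w × z ≢ w)

-- Whether x R y holds is not decidable constructively, but every claim is a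
-- negation, so we may case on R x y and R y x (double-negated excluded middle).
-- On the diagonal R^p only sees the bits p₈ and p₁: with both set R^p is
-- reflexive, which contradicts asymmetry and anti-transitivity at any point and
-- leaves a left-unique R^p no edge between distinct points; with neither set R^p
-- is irreflexive.  If moreover p₂ or p₄ is set, any two points are related by
-- R^p one way or the other, so two distinct points already refute left
-- uniqueness, and for p = F they are related both ways.
module Submission where

open import Defs
open import Level using (0ℓ)
open import Data.Bool using (true; false)
open import Data.Product using (_×_; _,_; proj₂)
open import Data.Sum using (_⊎_; inj₁; inj₂; [_,_]; swap)
open import Relation.Nullary using (¬_; Dec; yes; no; ¬¬-excluded-middle; contradiction)
open import Relation.Binary.PropositionalEquality using (_≡_; _≢_; refl; sym; trans; ≢-sym)

DiagonalFull : Hex → Set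
DiagonalFull p = p₈ p ≡ true × p₁ p ≡ true

DiagonalEmpty : Hex → Set
DiagonalEmpty p = p₈ p ≡ false × p₁ p ≡ false

OffDiagonal : Hex → Set
OffDiagonal p = p₂ p ≡ true ⊎ p₄ p ≡ true

diagonalFull-9BDF : ∀ {q} → q ≡ h9 ⊎ q ≡ hB ⊎ q ≡ hD ⊎ q ≡ hF → DiagonalFull q
diagonalFull-9BDF (inj₁ refl)               = refl , refl
diagonalFull-9BDF (inj₂ (inj₁ refl))        = refl , refl
diagonalFull-9BDF (inj₂ (inj₂ (inj₁ refl))) = refl , refl
diagonalFull-9BDF (inj₂ (inj₂ (inj₂ refl))) = refl , refl

diagonalEmpty-0246 : ∀ {q} → q ≡ h0 ⊎ q ≡ h2 ⊎ q ≡ h4 ⊎ q ≡ h6 → DiagonalEmpty q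
diagonalEmpty-0246 (inj₁ refl)               = refl , refl
diagonalEmpty-0246 (inj₂ (inj₁ refl))        = refl , refl
diagonalEmpty-0246 (inj₂ (inj₂ (inj₁ refl))) = refl , refl
diagonalEmpty-0246 (inj₂ (inj₂ (inj₂ refl))) = refl , refl

offDiagonal-BDF : ∀ {q} → q ≡ hB ⊎ q ≡ hD ⊎ q ≡ hF → OffDiagonal q
offDiagonal-BDF (inj₁ refl)        = inj₁ refl
offDiagonal-BDF (inj₂ (inj₁ refl)) = inj₂ refl
offDiagonal-BDF (inj₂ (inj₂ refl)) = inj₁ refl

module _ {a ℓ} {X : Set a} (S : Rel X ℓ) where

  asymmetric⇒irreflexive : Asymmetric S → ∀ x → ¬ S x x
  asymmetric⇒irreflexive asym x s = asym x x s s

  antiTransitive⇒irreflexive : AntiTransitive S → ∀ x → ¬ S x x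
  antiTransitive⇒irreflexive antitrans x s = antitrans x x x s s s

  leftUnique⇒¬related : LeftUnique S → (∀ y → ¬ ¬ S y y) → ∀ {x y} → x ≢ y → ¬ S x y
  leftUnique⇒¬related unique refl¬¬ {x} {y} x≢y s = refl¬¬ y λ s′ → x≢y (unique x y y s s′)

module _ {a ℓ} {X : Set a} (R : Rel X ℓ) where

  ^-¬¬reflexive : ∀ {p} → DiagonalFull p → ∀ x → ¬ ¬ (R ^ p) x x
  ^-¬¬reflexive (e₈ , e₁) x k = ¬¬-excluded-middle λ where
    (yes r) → k (inj₂ (inj₂ (inj₂ (r , r , e₁))))
    (no ¬r) → k (inj₁ (¬r , ¬r , e₈))

  ^-irreflexive : ∀ {p} → DiagonalEmpty p → ∀ x → ¬ (R ^ p) x x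
  ^-irreflexive (e₈ , e₁) x (inj₁ (_ , _ , e))               = contradiction (trans (sym e₈) e) λ ()
  ^-irreflexive (e₈ , e₁) x (inj₂ (inj₁ (¬r , r , _)))        = ¬r r
  ^-irreflexive (e₈ , e₁) x (inj₂ (inj₂ (inj₁ (r , ¬r , _)))) = ¬r r
  ^-irreflexive (e₈ , e₁) x (inj₂ (inj₂ (inj₂ (_ , _ , e))))  = contradiction (trans (sym e₁) e) λ ()

  ^h0-empty : ∀ {x y} → ¬ (R ^ h0) x y
  ^h0-empty (inj₁ (_ , _ , ()))
  ^h0-empty (inj₂ (inj₁ (_ , _ , ())))
  ^h0-empty (inj₂ (inj₂ (inj₁ (_ , _ , ()))))
  ^h0-empty (inj₂ (inj₂ (inj₂ (_ , _ , ()))))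

  ^-¬¬connex : ∀ {p} → DiagonalFull p → OffDiagonal p →
               ∀ x y → ¬ ¬ ((R ^ p) x y ⊎ (R ^ p) y x)
  ^-¬¬connex {p} (e₈ , e₁) off x y k =
    ¬¬-excluded-middle λ dxy → ¬¬-excluded-middle λ dyx → k (related dxy dyx)
    where
    oneWay : ∀ {u v} → ¬ R u v → R v u → (R ^ p) u v ⊎ (R ^ p) v u
    oneWay ¬r r = [ (λ e₂ → inj₂ (inj₂ (inj₂ (inj₁ (r , ¬r , e₂)))))
                  , (λ e₄ → inj₁ (inj₂ (inj₁ (¬r , r , e₄)))) ] off

    related : Dec (R x y) → Dec (R y x) → (R ^ p) x y ⊎ (R ^ p) y x
    related (no ¬rxy) (no ¬ryx) = inj₁ (inj₁ (¬rxy , ¬ryx , e₈))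
    related (no ¬rxy) (yes ryx) = oneWay ¬rxy ryx
    related (yes rxy) (no ¬ryx) = swap (oneWay ¬ryx rxy)
    related (yes rxy) (yes ryx) = inj₁ (inj₂ (inj₂ (inj₂ (rxy , ryx , e₁))))

  ¬¬-^hF : ∀ x y → ¬ ¬ (R ^ hF) x y
  ¬¬-^hF x y k = ¬¬-excluded-middle λ dxy → ¬¬-excluded-middle λ dyx → k (related dxy dyx)
    where
    related : Dec (R x y) → Dec (R y x) → (R ^ hF) x y
    related (no ¬rxy) (no ¬ryx) = inj₁ (¬rxy , ¬ryx , refl)
    related (no ¬rxy) (yes ryx) = inj₂ (inj₁ (¬rxy , ryx , refl))
    related (yes rxy) (no ¬ryx) = inj₂ (inj₂ (inj₁ (rxy , ¬ryx , refl)))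
    related (yes rxy) (yes ryx) = inj₂ (inj₂ (inj₂ (rxy , ryx , refl)))

  ¬antiSymmetric-^hF : ∀ {x y} → x ≢ y → ¬ AntiSymmetric (R ^ hF)
  ¬antiSymmetric-^hF {x} {y} x≢y antisym =
    ¬¬-^hF x y λ rxy → ¬¬-^hF y x λ ryx → antisym x y rxy x≢y ryx

  ¬leftUnique-^ : ∀ {p x y} → DiagonalFull p → OffDiagonal p → x ≢ y → ¬ LeftUnique (R ^ p)
  ¬leftUnique-^ {p} {x} {y} full off x≢y unique =
    ^-¬¬connex full off x y [ noEdge x≢y , noEdge (≢-sym x≢y) ]
    where
    noEdge : ∀ {u v} → u ≢ v → ¬ (R ^ p) u v
    noEdge = leftUnique⇒¬related (R ^ p) unique (^-¬¬reflexive full)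

mainTheorem3 : ((X : Set) → AtLeast1 X → (R : Rel X 0ℓ) →
    (∀ q → (q ≡ h9 ⊎ q ≡ hB ⊎ q ≡ hD ⊎ q ≡ hF) → ¬ Asymmetric (R ^ q))
    × (∀ q → (q ≡ h9 ⊎ q ≡ hB ⊎ q ≡ hD ⊎ q ≡ hF) → ¬ AntiTransitive (R ^ q))
    × ¬ LeftSerial (R ^ h0)
    × (∀ q → (q ≡ h0 ⊎ q ≡ h2 ⊎ q ≡ h4 ⊎ q ≡ h6) → ¬ Reflexive (R ^ q)))
    × ((X : Set) → AtLeast2 X → (R : Rel X 0ℓ) → ¬ AntiSymmetric (R ^ hF))
    × ((X : Set) → AtLeast4 X → (R : Rel X 0ℓ) →
    ∀ q → (q ≡ hB ⊎ q ≡ hD ⊎ q ≡ hF) → ¬ LeftUnique (R ^ q))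
mainTheorem3 = partA , partB , partC
  where
  partA : (X : Set) → AtLeast1 X → (R : Rel X 0ℓ) →
      (∀ q → (q ≡ h9 ⊎ q ≡ hB ⊎ q ≡ hD ⊎ q ≡ hF) → ¬ Asymmetric (R ^ q))
    × (∀ q → (q ≡ h9 ⊎ q ≡ hB ⊎ q ≡ hD ⊎ q ≡ hF) → ¬ AntiTransitive (R ^ q))
    × ¬ LeftSerial (R ^ h0)
    × (∀ q → (q ≡ h0 ⊎ q ≡ h2 ⊎ q ≡ h4 ⊎ q ≡ h6) → ¬ Reflexive (R ^ q))
  partA X x R =
      (λ q q∈ asym → ^-¬¬reflexive R (diagonalFull-9BDF q∈) x
                       (asymmetric⇒irreflexive (R ^ q) asym x))
    , (λ q q∈ antitrans → ^-¬¬reflexive R (diagonalFull-9BDF q∈) x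
                            (antiTransitive⇒irreflexive (R ^ q) antitrans x))
    , (λ serial → ^h0-empty R (proj₂ (serial x)))
    , (λ q q∈ refl′ → ^-irreflexive R (diagonalEmpty-0246 q∈) x (refl′ x))

  partB : (X : Set) → AtLeast2 X → (R : Rel X 0ℓ) → ¬ AntiSymmetric (R ^ hF)
  partB X (_ , _ , x≢y) R = ¬antiSymmetric-^hF R x≢y

  -- Only two of the four distinct points are needed.
  partC : (X : Set) → AtLeast4 X → (R : Rel X 0ℓ) →
          ∀ q → (q ≡ hB ⊎ q ≡ hD ⊎ q ≡ hF) → ¬ LeftUnique (R ^ q)
  partC X (_ , _ , _ , _ , x≢y , _) R q q∈ =
    ¬leftUnique-^ R (diagonalFull-9BDF (inj₂ q∈)) (offDiagonal-BDF q∈) x≢y
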